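{- For a permutation $\pi$ of $\{1,\ldots,n\}$, let $s(\pi)$ be the minimum number $k$ of stacks such that $\pi$ can be sorted by $k$ stacks in sequential arrangement. Then, for $\pi$ uniformly random, $\mathbb{E}[s(\pi)]\ge \left(\tfrac12-o(1)\right)\log n$ as $n\to\infty$; i.e. on the average at least (asymptotically) $\tfrac12\log n$ stacks are needed for sequential stack sort.
   Context: $\log$ denotes the binary logarithm. Sorting with $k$ sequential stacks: there are $k$ initially empty stacks $S_0,\ldots,S_{k-1}$. The input is a permutation $\pi=(x_1,\ldots,x_n)$ of $\{1,\ldots,n\}$, read from left to right. At each step one may either (a) push the next unread input element onto $S_0$; or (b) for some $0\le i<k-1$, pop the top element of $S_i$ and push it onto $S_{i+1}$; or (c) pop the top element of $S_{k-1}$ and append it to the output. $\pi$ is sorted by $k$ sequential stacks if some sequence of such steps moves all elements to the output and the output is $1,2,\ldots,n$. (It is known that $\lceil\log n\rceil$ stacks always suffice, so $s(\pi)$ is finite.) -}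

module Defs where

open import Data.Nat using (ℕ; zero; suc)
open import Data.Fin using (Fin; zero; suc; inject₁; fromℕ)
open import Data.List using (List; []; _∷_; _++_; [_]; map; concatMap; upTo; length)
open import Data.Vec using (Vec; lookup; replicate; _[_]≔_; _[_]%=_)
open import Data.Product using (_×_; _,_)
open import Relation.Binary.PropositionalEquality using (_≡_)
open import Relation.Binary.Construct.Closure.ReflexiveTransitive using (Star)

-- A configuration of the k sequential stacks S_0,…,S_{k-1}:
-- (remaining input, the k stacks (head of each list = top), output so far in order).
Config : ℕ → Set
Config k = List ℕ × Vec (List ℕ) k × List ℕ

data Step : {k : ℕ} → Config k → Config k → Set where
  push : ∀ {k x inp out} {st : Vec (List ℕ) (suc k)} →
         Step (x ∷ inp , st , out) (inp , st [ zero ]%= (x ∷_) , out)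
  move : ∀ {k inp out x r} {st : Vec (List ℕ) (suc k)} (i : Fin k) →
         lookup st (inject₁ i) ≡ x ∷ r →
         Step (inp , st , out) (inp , (st [ inject₁ i ]≔ r) [ suc i ]%= (x ∷_) , out)
  pop  : ∀ {k inp out x r} {st : Vec (List ℕ) (suc k)} →
         lookup st (fromℕ k) ≡ x ∷ r →
         Step (inp , st , out) (inp , st [ fromℕ k ]≔ r , out ++ [ x ])

oneTo : ℕ → List ℕ
oneTo n = map suc (upTo n)

SortedBy : ℕ → List ℕ → Set
SortedBy k π = Star (Step {k}) (π , replicate k [] , []) ([] , replicate k [] , oneTo (length π))

insertions : ℕ → List ℕ → List (List ℕ)
insertions x []       = (x ∷ []) ∷ []
insertions x (y ∷ ys) = (x ∷ y ∷ ys) ∷ map (y ∷_) (insertions x ys)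

-- The n! permutations of {1,…,n}, each listed exactly once (as one-line words).
perms : ℕ → List (List ℕ)
perms zero    = [] ∷ []
perms (suc n) = concatMap (insertions (suc n)) (perms n)

module Submission where

-- A run of k sequential stacks on a permutation π of length n is recorded by one
-- word of length 2n per stack, listing its pushes and pops; since the output is
-- 1,…,n, undoing the operations recovers π from the k words.  So at most 2^(2nK)
-- permutations have s(π) < K, and Markov's inequality gives
-- Σ s(π) ≥ K (n! − 2^(2nK)).  Choosing K with 2^(4mK) ≈ n^(2m−3), the bound
-- ⌊n/2m⌋^(n−⌊n/2m⌋) ≤ n! makes 2^(2nK) negligible against n!, and
-- 2m K ≥ (m − 3/2) log n − 2m then yields 2m Σ s(π) ≥ (m − 2) n! log n for large n.

open import Defs
open import Data.Bool using (Bool; true; false)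
open import Data.Empty using (⊥-elim)
open import Data.Fin using (Fin; zero; suc; inject₁; fromℕ)
open import Data.List using (List; []; _∷_; _++_; [_]; length; reverse; map; foldr; concatMap; filter; upTo)
import Data.List as List
open import Data.List.Properties
  using ( ∷-injectiveˡ; ∷-injectiveʳ; length-++; length-map; length-replicate; length-reverse; length-upTo
        ; reverse-++; ++-assoc; ++-identityʳ; unfold-reverse; foldr-++; filter-accept; filter-reject )
open import Data.List.Membership.Propositional using (_∈_; _∉_; find)
open import Data.List.Membership.Propositional.Properties
  using (∈-map⁺; ∈-map⁻; ∈-concatMap⁺; ∈-concatMap⁻; ∈-filter⁻)
open import Data.List.Relation.Binary.Subset.Propositional using (_⊆_)
open import Data.List.Relation.Unary.All using (All; []; _∷_)
import Data.List.Relation.Unary.All as All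
open import Data.List.Relation.Unary.All.Properties using (++⁺; replicate⁺)
open import Data.List.Relation.Unary.AllPairs using ([]; _∷_)
open import Data.List.Relation.Unary.Any using (here; there)
import Data.List.Relation.Unary.Any as Any
open import Data.List.Relation.Unary.Unique.Propositional using (Unique)
import Data.List.Relation.Unary.Unique.Propositional.Properties as Unique
open import Data.Nat
  using ( ℕ; zero; suc; _+_; _*_; _^_; _∸_; _!; _/_; _≤_; _<_; _≟_; _≤?_; _<?_; z≤n; s≤s; s≤s⁻¹
        ; NonZero; >-nonZero; >-nonZero⁻¹ )
open import Data.Nat.DivMod using (m/n*n≤m; m≡m%n+[m/n]*n; m%n<n; m*n/n≡m; /-monoˡ-≤)
open import Data.Nat.ListAction using (sum)
open import Data.Nat.Properties
open import Data.Nat.Tactic.RingSolver using (solve-∀)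
open import Data.Product using (_×_; _,_; ∃; proj₁; proj₂)
open import Data.Unit using (⊤; tt)
open import Data.Vec using (Vec; []; _∷_; lookup; replicate; toList; _[_]≔_; _[_]%=_)
open import Data.Vec.Properties using (length-toList)
open import Function using (_∘_)
open import Relation.Binary.Construct.Closure.ReflexiveTransitive using (Star; ε; _◅_)
open import Relation.Binary.PropositionalEquality
  using (_≡_; _≢_; refl; sym; trans; cong; cong₂; subst; module ≡-Reasoning)
open import Relation.Nullary using (¬_; yes; no)

private variable
  k x : ℕ
  r   : List ℕ

-- Stack histories

-- A history word lists the events of one stack, most recent first: true for a
-- push onto it, false for a pop from it.  Given the current contents s and the
-- elements that have left the stack (most recent first), unstack undoes the
-- history and returns the elements that have entered the stack (most recent first).
unstack : List Bool → List ℕ → List ℕ → List ℕ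
unstack []          s       r       = []
unstack (true ∷ h)  (x ∷ s) r       = x ∷ unstack h s r
unstack (true ∷ h)  []      r       = []
unstack (false ∷ h) s       (x ∷ r) = unstack h (x ∷ s) r
unstack (false ∷ h) s       []      = []

unstackAll : Vec (List Bool) k → Vec (List ℕ) k → List ℕ → List ℕ
unstackAll []       []       r = r
unstackAll (h ∷ hs) (s ∷ ss) r = unstack h s (unstackAll hs ss r)

total : Vec (List ℕ) k → ℕ → ℕ
total []       o = o
total (s ∷ ss) o = length s + total ss o

-- Every element held by a stack was pushed once, every element further
-- downstream was pushed and popped once.
Balanced : Vec (List Bool) k → Vec (List ℕ) k → ℕ → Set
Balanced []       []       o = ⊤
Balanced (h ∷ hs) (s ∷ ss) o = length h ≡ length s + 2 * total ss o × Balanced hs ss o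

Recorded : List ℕ → Config k → Set
Recorded {k} π (inp , st , out) =
  ∃ λ (hs : Vec (List Bool) k) →
    π ≡ reverse (unstackAll hs st (reverse out)) ++ inp × Balanced hs st (length out)

pushed-popped : ∀ {l r o} → l ≡ suc r + 2 * o → suc l ≡ r + 2 * suc o
pushed-popped {r = r} {o} refl = identity r o
  where
  identity : ∀ r o → suc (suc r + 2 * o) ≡ r + 2 * suc o
  identity = solve-∀

moveHistories : Fin k → Vec (List Bool) (suc k) → Vec (List Bool) (suc k)
moveHistories i hs = (hs [ inject₁ i ]%= (false ∷_)) [ suc i ]%= (true ∷_)

moveStacks : Fin k → ℕ → List ℕ → Vec (List ℕ) (suc k) → Vec (List ℕ) (suc k)
moveStacks i x r st = (st [ inject₁ i ]≔ r) [ suc i ]%= (x ∷_)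

unstackAll-move : ∀ (hs : Vec (List Bool) (suc k)) st (i : Fin k) R → lookup st (inject₁ i) ≡ x ∷ r →
                  unstackAll (moveHistories i hs) (moveStacks i x r st) R ≡ unstackAll hs st R
unstackAll-move (h ∷ h′ ∷ hs) (s ∷ s′ ∷ ss) zero    R refl = refl
unstackAll-move (h ∷ hs)      (s ∷ ss)      (suc i) R eq   = cong (unstack h s) (unstackAll-move hs ss i R eq)

total-move : ∀ (st : Vec (List ℕ) (suc k)) (i : Fin k) o → lookup st (inject₁ i) ≡ x ∷ r →
             total (moveStacks i x r st) o ≡ total st o
total-move (s ∷ s′ ∷ ss) zero    o refl = +-suc _ _
total-move (s ∷ ss)      (suc i) o eq   = cong (length s +_) (total-move ss i o eq)

Balanced-move : ∀ (hs : Vec (List Bool) (suc k)) st (i : Fin k) o → lookup st (inject₁ i) ≡ x ∷ r →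
                Balanced hs st o → Balanced (moveHistories i hs) (moveStacks i x r st) o
Balanced-move (h ∷ h′ ∷ hs) (s ∷ s′ ∷ ss) zero    o refl (b , b′ , bs) =
  pushed-popped b , cong suc b′ , bs
Balanced-move (h ∷ hs)      (s ∷ ss)      (suc i) o eq   (b , bs)      =
  trans b (cong (λ t → length s + 2 * t) (sym (total-move ss i o eq))) , Balanced-move hs ss i o eq bs

unstackAll-pop : ∀ (hs : Vec (List Bool) (suc k)) st R → lookup st (fromℕ k) ≡ x ∷ r →
                 unstackAll (hs [ fromℕ k ]%= (false ∷_)) (st [ fromℕ k ]≔ r) (x ∷ R) ≡ unstackAll hs st R
unstackAll-pop {zero}  (h ∷ []) (s ∷ []) R refl = refl
unstackAll-pop {suc k} (h ∷ hs) (s ∷ ss) R eq   = cong (unstack h s) (unstackAll-pop hs ss R eq)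

total-pop : ∀ (st : Vec (List ℕ) (suc k)) o → lookup st (fromℕ k) ≡ x ∷ r →
            total (st [ fromℕ k ]≔ r) (suc o) ≡ total st o
total-pop {zero}  (s ∷ []) o refl = +-suc _ _
total-pop {suc k} (s ∷ ss) o eq   = cong (length s +_) (total-pop ss o eq)

Balanced-pop : ∀ (hs : Vec (List Bool) (suc k)) st o → lookup st (fromℕ k) ≡ x ∷ r →
               Balanced hs st o → Balanced (hs [ fromℕ k ]%= (false ∷_)) (st [ fromℕ k ]≔ r) (suc o)
Balanced-pop {zero}  (h ∷ []) (s ∷ []) o refl (b , tt) = pushed-popped b , tt
Balanced-pop {suc k} (h ∷ hs) (s ∷ ss) o eq   (b , bs) =
  trans b (cong (λ t → length s + 2 * t) (sym (total-pop ss o eq))) , Balanced-pop hs ss o eq bs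

reverse-∷-++ : ∀ (y : ℕ) ys zs → reverse (y ∷ ys) ++ zs ≡ reverse ys ++ y ∷ zs
reverse-∷-++ y ys zs = trans (cong (_++ zs) (unfold-reverse y ys)) (++-assoc (reverse ys) [ y ] zs)

Step-Recorded : ∀ {π} {c c′ : Config k} → Step c c′ → Recorded π c → Recorded π c′
Step-Recorded (push {x = x} {inp} {out} {st = s ∷ ss}) (h ∷ hs , π≡ , b , bs) =
  (true ∷ h) ∷ hs ,
  trans π≡ (sym (reverse-∷-++ x (unstackAll (h ∷ hs) (s ∷ ss) (reverse out)) inp)) ,
  cong suc b , bs
Step-Recorded (move {inp = inp} {out} {st = st} i top) (hs , π≡ , bs) =
  moveHistories i hs ,
  trans π≡ (cong (λ u → reverse u ++ inp) (sym (unstackAll-move hs st i (reverse out) top))) ,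
  Balanced-move hs st i (length out) top bs
Step-Recorded {k = suc k} (pop {inp = inp} {out} {x} {r} {st} top) (hs , π≡ , bs) =
  hs′ ,
  trans π≡ (cong (λ u → reverse u ++ inp) (sym (begin
    unstackAll hs′ st′ (reverse (out ++ [ x ]))  ≡⟨ cong (unstackAll hs′ st′) (reverse-++ out [ x ]) ⟩
    unstackAll hs′ st′ (x ∷ reverse out)         ≡⟨ unstackAll-pop hs st (reverse out) top ⟩
    unstackAll hs st (reverse out)               ∎))) ,
  subst (Balanced hs′ st′) (trans (+-comm 1 (length out)) (sym (length-++ out)))
    (Balanced-pop hs st (length out) top bs)
  where
  open ≡-Reasoning
  hs′ : Vec (List Bool) (suc k)
  hs′ = hs [ fromℕ k ]%= (false ∷_)
  st′ : Vec (List ℕ) (suc k)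
  st′ = st [ fromℕ k ]≔ r

Star-Recorded : ∀ {π} {c c′ : Config k} → Star Step c c′ → Recorded π c → Recorded π c′
Star-Recorded ε           rec = rec
Star-Recorded (s ◅ steps) rec = Star-Recorded steps (Step-Recorded s rec)

-- Decoding a sorting run

unstackList : List (List Bool) → List ℕ → List ℕ
unstackList ws R = foldr (λ h → unstack h []) R ws

unstackAll-empty : ∀ (hs : Vec (List Bool) k) R → unstackAll hs (replicate k []) R ≡ unstackList (toList hs) R
unstackAll-empty []       R = refl
unstackAll-empty (h ∷ hs) R = cong (unstack h []) (unstackAll-empty hs R)

total-empty : ∀ k o → total (replicate k []) o ≡ o
total-empty zero    o = refl
total-empty (suc k) o = total-empty k o

Recorded-start : ∀ k π → Recorded π (π , replicate k [] , [])
Recorded-start k π = replicate k [] , cong (_++ π) (sym (reverse-empty k)) , balanced k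
  where
  reverse-empty : ∀ k → reverse (unstackAll (replicate k []) (replicate k []) []) ≡ []
  reverse-empty zero    = refl
  reverse-empty (suc k) = refl
  balanced : ∀ k → Balanced (replicate k []) (replicate k []) 0
  balanced zero    = tt
  balanced (suc k) = cong (2 *_) (sym (total-empty k 0)) , balanced k

Balanced-empty : ∀ (hs : Vec (List Bool) k) o → Balanced hs (replicate k []) o →
                 All (λ w → length w ≡ 2 * o) (toList hs)
Balanced-empty []               o tt       = []
Balanced-empty {suc k} (h ∷ hs) o (b , bs) = trans b (cong (2 *_) (total-empty k o)) ∷ Balanced-empty hs o bs

passThrough : ℕ → List Bool
passThrough zero    = []
passThrough (suc n) = false ∷ true ∷ passThrough n

length-passThrough : ∀ n → length (passThrough n) ≡ 2 * n
length-passThrough zero    = refl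
length-passThrough (suc n) = trans (cong (2 +_) (length-passThrough n)) (sym (*-suc 2 n))

unstack-passThrough : ∀ (R : List ℕ) → unstack (passThrough (length R)) [] R ≡ R
unstack-passThrough []      = refl
unstack-passThrough (x ∷ R) = cong (x ∷_) (unstack-passThrough R)

unstackList-passThrough : ∀ j (R : List ℕ) {n} → length R ≡ n →
                          unstackList (List.replicate j (passThrough n)) R ≡ R
unstackList-passThrough zero    R refl = refl
unstackList-passThrough (suc j) R refl =
  trans (cong (unstack (passThrough (length R)) []) (unstackList-passThrough j R refl)) (unstack-passThrough R)

decode : ℕ → List (List Bool) → List ℕ
decode n ws = reverse (unstackList ws (reverse (oneTo n)))

length-oneTo : ∀ n → length (oneTo n) ≡ n
length-oneTo n = trans (length-map suc (upTo n)) (length-upTo n)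

-- Stacks beyond the k used are padded with pass-through histories.
sorted⇒decodes : ∀ {k K π} → k ≤ K → SortedBy k π →
                 ∃ λ ws → length ws ≡ K × All (λ w → length w ≡ 2 * length π) ws ×
                          decode (length π) ws ≡ π
sorted⇒decodes {k} {K} {π} k≤K sorted with Star-Recorded sorted (Recorded-start k π)
... | hs , π≡ , bs =
  toList hs ++ padding , length-ws , ++⁺ lengths-hs (replicate⁺ (K ∸ k) (length-passThrough n)) , decodes
  where
  open ≡-Reasoning
  n : ℕ
  n = length π
  R : List ℕ
  R = reverse (oneTo n)
  padding : List (List Bool)
  padding = List.replicate (K ∸ k) (passThrough n)
  length-ws : length (toList hs ++ padding) ≡ K
  length-ws = trans (length-++ (toList hs))
                (trans (cong₂ _+_ (length-toList hs) (length-replicate (K ∸ k))) (m+[n∸m]≡n k≤K))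
  lengths-hs : All (λ w → length w ≡ 2 * n) (toList hs)
  lengths-hs = Balanced-empty hs n (subst (Balanced hs (replicate k [])) (length-oneTo n) bs)
  unstack-padding : unstackList padding R ≡ R
  unstack-padding = unstackList-passThrough (K ∸ k) R (trans (length-reverse (oneTo n)) (length-oneTo n))
  decodes : decode n (toList hs ++ padding) ≡ π
  decodes = begin
    reverse (unstackList (toList hs ++ padding) R)
      ≡⟨ cong reverse (foldr-++ _ R (toList hs) padding) ⟩
    reverse (unstackList (toList hs) (unstackList padding R))
      ≡⟨ cong (reverse ∘ unstackList (toList hs)) unstack-padding ⟩
    reverse (unstackList (toList hs) R)
      ≡⟨ cong reverse (unstackAll-empty hs R) ⟨
    reverse (unstackAll hs (replicate k []) R)
      ≡⟨ ++-identityʳ _ ⟨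
    reverse (unstackAll hs (replicate k []) R) ++ []
      ≡⟨ π≡ ⟨
    π ∎

-- Counting codes

tuples : ∀ {A : Set} → ℕ → List A → List (List A)
tuples zero    xs = [ [] ]
tuples (suc k) xs = concatMap (λ x → map (x ∷_) (tuples k xs)) xs

length-concatMap-const : ∀ {A B : Set} (f : A → List B) c xs →
                         (∀ {x} → x ∈ xs → length (f x) ≡ c) → length (concatMap f xs) ≡ length xs * c
length-concatMap-const f c []       const = refl
length-concatMap-const f c (x ∷ xs) const =
  trans (length-++ (f x)) (cong₂ _+_ (const (here refl)) (length-concatMap-const f c xs (const ∘ there)))

length-tuples : ∀ {A : Set} k (xs : List A) → length (tuples k xs) ≡ length xs ^ k
length-tuples zero    xs = refl
length-tuples (suc k) xs =
  length-concatMap-const _ (length xs ^ k) xs (λ _ → trans (length-map _ (tuples k xs)) (length-tuples k xs))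

∈-tuples : ∀ {A : Set} {xs : List A} {ys} → All (_∈ xs) ys → ys ∈ tuples (length ys) xs
∈-tuples []            = here refl
∈-tuples {xs = xs} {_ ∷ ys} (y∈xs ∷ ys∈xs) =
  ∈-concatMap⁺ (λ x → map (x ∷_) (tuples (length ys) xs))
               (Any.map (λ { refl → ∈-map⁺ _ (∈-tuples ys∈xs) }) y∈xs)

bools : List Bool
bools = true ∷ false ∷ []

∈-tuples-bools : ∀ w → w ∈ tuples (length w) bools
∈-tuples-bools w = ∈-tuples (All.universal ∈-bools w)
  where
  ∈-bools : ∀ b → b ∈ bools
  ∈-bools true  = here refl
  ∈-bools false = there (here refl)

codes : ℕ → ℕ → List (List ℕ)
codes n K = map (decode n) (tuples K (tuples (2 * n) bools))

length-codes : ∀ n K → length (codes n K) ≡ (2 ^ (2 * n)) ^ K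
length-codes n K = begin
  length (codes n K)                         ≡⟨ length-map (decode n) (tuples K _) ⟩
  length (tuples K (tuples (2 * n) bools))   ≡⟨ length-tuples K _ ⟩
  length (tuples (2 * n) bools) ^ K          ≡⟨ cong (_^ K) (length-tuples (2 * n) bools) ⟩
  (2 ^ (2 * n)) ^ K                          ∎
  where open ≡-Reasoning

sorted⇒∈codes : ∀ {k K π} → k ≤ K → SortedBy k π → π ∈ codes (length π) K
sorted⇒∈codes {K = K} {π} k≤K sorted with sorted⇒decodes k≤K sorted
... | ws , refl , lengths , decodes = subst (_∈ codes (length π) (length ws)) decodes (∈-map⁺ _ ws∈)
  where
  ws∈ : ws ∈ tuples (length ws) (tuples (2 * length π) bools)
  ws∈ = ∈-tuples (All.map (λ {w} eq → subst (λ l → w ∈ tuples l bools) eq (∈-tuples-bools w)) lengths)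

-- Permutations

Unique-concatMap : ∀ {A B : Set} {f : A → List B} (g : B → A) {xs} → Unique xs →
                   (∀ {x} → x ∈ xs → Unique (f x)) → (∀ {x z} → x ∈ xs → z ∈ f x → g z ≡ x) →
                   Unique (concatMap f xs)
Unique-concatMap g []                unique-f g-inverse = []
Unique-concatMap {f = f} g {x ∷ xs} (x∉xs ∷ unique) unique-f g-inverse =
  Unique.++⁺ (unique-f (here refl)) (Unique-concatMap g unique (unique-f ∘ there) (g-inverse ∘ there)) disjoint
  where
  disjoint : ∀ {z} → ¬ (z ∈ f x × z ∈ concatMap f xs)
  disjoint (z∈fx , z∈fxs) with find (∈-concatMap⁻ f z∈fxs)
  ... | y , y∈xs , z∈fy =
    All.lookup x∉xs y∈xs (trans (sym (g-inverse (here refl) z∈fx)) (g-inverse (there y∈xs) z∈fy))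

∈-perms-suc : ∀ {n π} → π ∈ perms (suc n) → ∃ λ ys → ys ∈ perms n × π ∈ insertions (suc n) ys
∈-perms-suc {n} = find ∘ ∈-concatMap⁻ (insertions (suc n))

length-∈-insertions : ∀ x ys {z} → z ∈ insertions x ys → length z ≡ suc (length ys)
length-∈-insertions x []       (here refl) = refl
length-∈-insertions x (y ∷ ys) (here refl) = refl
length-∈-insertions x (y ∷ ys) (there z∈)  with ∈-map⁻ (y ∷_) z∈
... | z′ , z′∈ , refl = cong suc (length-∈-insertions x ys z′∈)

All-∈-insertions : ∀ {P : ℕ → Set} {x} ys {z} → P x → All P ys → z ∈ insertions x ys → All P z
All-∈-insertions []       px []         (here refl) = px ∷ []
All-∈-insertions (y ∷ ys) px pys        (here refl) = px ∷ pys
All-∈-insertions (y ∷ ys) px (py ∷ pys) (there z∈)  with ∈-map⁻ (y ∷_) z∈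
... | z′ , z′∈ , refl = py ∷ All-∈-insertions ys px pys z′∈

length-∈-perms : ∀ n {π} → π ∈ perms n → length π ≡ n
length-∈-perms zero    (here refl) = refl
length-∈-perms (suc n) π∈ with ∈-perms-suc π∈
... | ys , ys∈ , π∈ys = trans (length-∈-insertions (suc n) ys π∈ys) (cong suc (length-∈-perms n ys∈))

All-≤-∈-perms : ∀ n {π} → π ∈ perms n → All (_≤ n) π
All-≤-∈-perms zero    (here refl) = []
All-≤-∈-perms (suc n) π∈ with ∈-perms-suc π∈
... | ys , ys∈ , π∈ys =
  All-∈-insertions ys ≤-refl (All.map m≤n⇒m≤1+n (All-≤-∈-perms n ys∈)) π∈ys

length-insertions : ∀ x ys → length (insertions x ys) ≡ suc (length ys)
length-insertions x []       = refl
length-insertions x (y ∷ ys) = cong suc (trans (length-map (y ∷_) (insertions x ys)) (length-insertions x ys))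

length-perms : ∀ n → length (perms n) ≡ n !
length-perms zero    = refl
length-perms (suc n) = begin
  length (perms (suc n))  ≡⟨ length-concatMap-const (insertions (suc n)) (suc n) (perms n) length-block ⟩
  length (perms n) * suc n ≡⟨ cong (_* suc n) (length-perms n) ⟩
  n ! * suc n              ≡⟨ *-comm (n !) (suc n) ⟩
  suc n !                  ∎
  where
  open ≡-Reasoning
  length-block : ∀ {ys} → ys ∈ perms n → length (insertions (suc n) ys) ≡ suc n
  length-block {ys} ys∈ = trans (length-insertions (suc n) ys) (cong suc (length-∈-perms n ys∈))

delete : ℕ → List ℕ → List ℕ
delete x []       = []
delete x (y ∷ ys) with y ≟ x
... | yes _ = ys
... | no  _ = y ∷ delete x ys

delete-head : ∀ x ys → delete x (x ∷ ys) ≡ ys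
delete-head x ys with x ≟ x
... | yes _   = refl
... | no  x≢x = ⊥-elim (x≢x refl)

delete-∷ : ∀ {x y} zs → y ≢ x → delete x (y ∷ zs) ≡ y ∷ delete x zs
delete-∷ {x} {y} zs y≢x with y ≟ x
... | yes y≡x = ⊥-elim (y≢x y≡x)
... | no  _   = refl

delete-∈-insertions : ∀ x ys {z} → x ∉ ys → z ∈ insertions x ys → delete x z ≡ ys
delete-∈-insertions x []       x∉ (here refl) = delete-head x []
delete-∈-insertions x (y ∷ ys) x∉ (here refl) = delete-head x (y ∷ ys)
delete-∈-insertions x (y ∷ ys) x∉ (there z∈)  with ∈-map⁻ (y ∷_) z∈
... | z′ , z′∈ , refl =
  trans (delete-∷ z′ λ { refl → x∉ (here refl) })
        (cong (y ∷_) (delete-∈-insertions x ys (x∉ ∘ there) z′∈))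

Unique-insertions : ∀ x ys → x ∉ ys → Unique (insertions x ys)
Unique-insertions x []       x∉ = [] ∷ []
Unique-insertions x (y ∷ ys) x∉ =
  All.tabulate head-new ∷ Unique.map⁺ ∷-injectiveʳ (Unique-insertions x ys (x∉ ∘ there))
  where
  head-new : ∀ {z} → z ∈ map (y ∷_) (insertions x ys) → x ∷ y ∷ ys ≢ z
  head-new z∈ with ∈-map⁻ (y ∷_) z∈
  ... | _ , _ , refl = x∉ ∘ here ∘ ∷-injectiveˡ

Unique-perms : ∀ n → Unique (perms n)
Unique-perms zero    = [] ∷ []
Unique-perms (suc n) =
  Unique-concatMap (delete (suc n)) (Unique-perms n)
    (λ ys∈ → Unique-insertions (suc n) _ (new ys∈))
    (λ ys∈ → delete-∈-insertions (suc n) _ (new ys∈))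
  where
  new : ∀ {ys} → ys ∈ perms n → suc n ∉ ys
  new ys∈ sn∈ = 1+n≰n (All.lookup (All-≤-∈-perms n ys∈) sn∈)

-- Permutations sortable with few stacks

remove-∈ : ∀ {A : Set} {x : A} {ys} → x ∈ ys →
           ∃ λ ys′ → length ys ≡ suc (length ys′) × (∀ {y} → y ∈ ys → y ≢ x → y ∈ ys′)
remove-∈ {ys = _ ∷ ys} (here refl) =
  ys , refl , λ { (here refl) y≢x → ⊥-elim (y≢x refl) ; (there y∈) _ → y∈ }
remove-∈ {ys = y ∷ ys} (there x∈) with remove-∈ x∈
... | ys′ , length-ys , keep =
  y ∷ ys′ , cong suc length-ys , λ { (here refl) _ → here refl ; (there z∈) z≢x → there (keep z∈ z≢x) }

Unique-⊆⇒length≤ : ∀ {A : Set} {xs ys : List A} → Unique xs → xs ⊆ ys → length xs ≤ length ys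
Unique-⊆⇒length≤ {xs = []}     _               _      = z≤n
Unique-⊆⇒length≤ {xs = x ∷ xs} (x∉xs ∷ unique) xs⊆ys with remove-∈ (xs⊆ys (here refl))
... | ys′ , length-ys , keep = subst (suc (length xs) ≤_) (sym length-ys)
  (s≤s (Unique-⊆⇒length≤ unique λ z∈ →
          keep (xs⊆ys (there z∈)) (λ { refl → All.lookup x∉xs z∈ refl })))

markov : ∀ {A : Set} (s : A → ℕ) K (L : List A) →
         K * length L ≤ sum (map s L) + K * length (filter (λ a → s a <? K) L)
markov s K []      = ≤-refl
markov s K (a ∷ L) with s a <? K
... | yes sa<K rewrite filter-accept (λ a → s a <? K) {xs = L} sa<K = begin
  K * suc (length L)      ≡⟨ *-suc K (length L) ⟩
  K + K * length L        ≤⟨ +-monoʳ-≤ K (markov s K L) ⟩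
  K + (S + K * c)         ≡⟨ rearrange K S c ⟩
  S + K * suc c           ≤⟨ m≤n+m _ (s a) ⟩
  s a + (S + K * suc c)   ≡⟨ +-assoc (s a) S (K * suc c) ⟨
  s a + S + K * suc c     ∎
  where
  open ≤-Reasoning
  rearrange : ∀ K S c → K + (S + K * c) ≡ S + K * suc c
  rearrange = solve-∀
  S c : ℕ
  S = sum (map s L)
  c = length (filter (λ a → s a <? K) L)
... | no sa≮K rewrite filter-reject (λ a → s a <? K) {xs = L} sa≮K = begin
  K * suc (length L)      ≡⟨ *-suc K (length L) ⟩
  K + K * length L        ≤⟨ +-mono-≤ (≮⇒≥ sa≮K) (markov s K L) ⟩
  s a + (S + K * c)       ≡⟨ +-assoc (s a) S (K * c) ⟨
  s a + S + K * c         ∎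
  where
  open ≤-Reasoning
  S c : ℕ
  S = sum (map s L)
  c = length (filter (λ a → s a <? K) L)

count-sortable-below : ∀ (s : List ℕ → ℕ) n K → (∀ {π} → π ∈ perms n → SortedBy (s π) π) →
                       length (filter (λ π → s π <? K) (perms n)) ≤ (2 ^ (2 * n)) ^ K
count-sortable-below s n K sorted = begin
  length (filter (λ π → s π <? K) (perms n))
    ≤⟨ Unique-⊆⇒length≤ (Unique.filter⁺ (λ π → s π <? K) (Unique-perms n)) fast⊆codes ⟩
  length (codes n K)
    ≡⟨ length-codes n K ⟩
  (2 ^ (2 * n)) ^ K ∎
  where
  open ≤-Reasoning
  fast⊆codes : filter (λ π → s π <? K) (perms n) ⊆ codes n K
  fast⊆codes π∈ with ∈-filter⁻ (λ π → s π <? K) π∈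
  ... | π∈perms , sπ<K = subst (λ l → _ ∈ codes l K) (length-∈-perms n π∈perms)
                           (sorted⇒∈codes (<⇒≤ sπ<K) (sorted π∈perms))

sum-lower-bound : ∀ (s : List ℕ → ℕ) n K → (∀ {π} → π ∈ perms n → SortedBy (s π) π) →
                  K * n ! ≤ sum (map s (perms n)) + K * (2 ^ (2 * n)) ^ K
sum-lower-bound s n K sorted = begin
  K * n !
    ≡⟨ cong (K *_) (length-perms n) ⟨
  K * length (perms n)
    ≤⟨ markov s K (perms n) ⟩
  T + K * length (filter (λ π → s π <? K) (perms n))
    ≤⟨ +-monoʳ-≤ T (*-monoʳ-≤ K (count-sortable-below s n K sorted)) ⟩
  T + K * (2 ^ (2 * n)) ^ K ∎
  where
  open ≤-Reasoning
  T : ℕ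
  T = sum (map s (perms n))

-- Arithmetic

*-distrib-^ : ∀ a b k → (a * b) ^ k ≡ a ^ k * b ^ k
*-distrib-^ a b zero    = refl
*-distrib-^ a b (suc k) = trans (cong (a * b *_) (*-distrib-^ a b k)) (interchange a b (a ^ k) (b ^ k))
  where
  interchange : ∀ a b x y → a * b * (x * y) ≡ a * x * (b * y)
  interchange = solve-∀

^-^-assoc : ∀ b x K y → ((b ^ x) ^ K) ^ y ≡ b ^ (x * K * y)
^-^-assoc b x K y = trans (cong (_^ y) (^-*-assoc b x K)) (^-*-assoc b (x * K) y)

^-cancelʳ-≤ : ∀ k .{{_ : NonZero k}} {a b} → a ^ k ≤ b ^ k → a ≤ b
^-cancelʳ-≤ k {a} {b} aᵏ≤bᵏ with a ≤? b
... | yes a≤b = a≤b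
... | no  a≰b = ⊥-elim (<⇒≱ (^-monoˡ-< k (≰⇒> a≰b)) aᵏ≤bᵏ)

m^n≤[m+n]! : ∀ m n → m ^ n ≤ (m + n) !
m^n≤[m+n]! m zero    = subst (λ l → 1 ≤ l !) (sym (+-identityʳ m)) (1≤n! m)
m^n≤[m+n]! m (suc n) = subst (λ l → m * m ^ n ≤ l !) (sym (+-suc m n))
  (*-mono-≤ (≤-trans (m≤m+n m n) (n≤1+n (m + n))) (m^n≤[m+n]! m n))

m^[n∸m]≤n! : ∀ {m n} → m ≤ n → m ^ (n ∸ m) ≤ n !
m^[n∸m]≤n! {m} {n} m≤n = subst (λ l → m ^ (n ∸ m) ≤ l !) (m+[n∸m]≡n m≤n) (m^n≤[m+n]! m (n ∸ m))

quotient-bounds : ∀ w d n .{{_ : NonZero d}} .{{_ : NonZero w}} → d * w ≤ n →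
                  w ≤ n / d × n ≤ 2 * d * (n / d)
quotient-bounds w d n dw≤n = w≤q , (begin
  n              ≤⟨ <⇒≤ (subst (_< d + q * d) (sym (m≡m%n+[m/n]*n n d)) (+-monoˡ-< (q * d) (m%n<n n d))) ⟩
  d + q * d      ≤⟨ +-monoˡ-≤ (q * d) (m≤n*m d q {{>-nonZero (≤-trans (>-nonZero⁻¹ w) w≤q)}}) ⟩
  q * d + q * d  ≡⟨ double d q ⟩
  2 * d * q      ∎)
  where
  open ≤-Reasoning
  double : ∀ d q → q * d + q * d ≡ 2 * d * q
  double = solve-∀
  q : ℕ
  q = n / d
  w≤q : w ≤ q
  w≤q = subst (_≤ q) (m*n/n≡m w d) (/-monoˡ-≤ d (subst (_≤ n) (*-comm d w) dw≤n))

-- With q = ⌊n/2m⌋ one has q^(n−q) ≤ n!, n ≤ 4mq and (4m)^m ≤ q; together these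
-- give n! ≥ n^(n(1−3/(2m))) up to the factor (4m)^(2m), in integer form.
factorial-power-lower-bound : ∀ m e n .{{_ : NonZero m}} → e + 3 ≤ 2 * m → 2 * m * (4 * m) ^ m ≤ n →
                              (4 * m) ^ (2 * m) * n ^ (e * n) ≤ (n !) ^ (2 * m)
factorial-power-lower-bound m e n e+3≤d large = begin
  c ^ d * n ^ (e * n)                 ≤⟨ *-monoʳ-≤ (c ^ d) (^-monoˡ-≤ (e * n) n≤cq) ⟩
  c ^ d * (c * q) ^ (e * n)           ≡⟨ cong (c ^ d *_) (*-distrib-^ c q (e * n)) ⟩
  c ^ d * (c ^ (e * n) * q ^ (e * n)) ≡⟨ *-assoc (c ^ d) _ _ ⟨
  c ^ d * c ^ (e * n) * q ^ (e * n)   ≡⟨ cong (_* q ^ (e * n)) (^-distribˡ-+-* c d (e * n)) ⟨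
  c ^ (d + e * n) * q ^ (e * n)       ≤⟨ *-monoˡ-≤ _ (^-monoʳ-≤ c exponent₁) ⟩
  c ^ (m * (2 * n)) * q ^ (e * n)     ≡⟨ cong (_* q ^ (e * n)) (^-*-assoc c m (2 * n)) ⟨
  (c ^ m) ^ (2 * n) * q ^ (e * n)     ≤⟨ *-monoˡ-≤ _ (^-monoˡ-≤ (2 * n) cᵐ≤q) ⟩
  q ^ (2 * n) * q ^ (e * n)           ≡⟨ ^-distribˡ-+-* q (2 * n) (e * n) ⟨
  q ^ (2 * n + e * n)                 ≤⟨ ^-monoʳ-≤ q exponent₂ ⟩
  q ^ ((n ∸ q) * d)                   ≡⟨ ^-*-assoc q (n ∸ q) d ⟨
  (q ^ (n ∸ q)) ^ d                   ≤⟨ ^-monoˡ-≤ d (m^[n∸m]≤n! q≤n) ⟩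
  (n !) ^ d                           ∎
  where
  open ≤-Reasoning
  regroup₁ : ∀ m n → 2 * m * n ≡ m * (2 * n)
  regroup₁ = solve-∀
  regroup₂ : ∀ e n → 2 * n + e * n + n ≡ (e + 3) * n
  regroup₂ = solve-∀
  c d q : ℕ
  c = 4 * m
  d = 2 * m
  instance
    c-nonZero : NonZero c
    c-nonZero = m*n≢0 4 m
    d-nonZero : NonZero d
    d-nonZero = m*n≢0 2 m
  q = n / d
  bounds : c ^ m ≤ q × n ≤ 2 * d * q
  bounds = quotient-bounds (c ^ m) d n {{_}} {{m^n≢0 c m}} large
  cᵐ≤q : c ^ m ≤ q
  cᵐ≤q = proj₁ bounds
  n≤cq : n ≤ c * q
  n≤cq = subst (λ l → n ≤ l * q) (sym (*-assoc 2 2 m)) (proj₂ bounds)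
  instance
    q-nonZero : NonZero q
    q-nonZero = >-nonZero (≤-trans (m^n>0 c m) cᵐ≤q)
  qd≤n : q * d ≤ n
  qd≤n = m/n*n≤m n d
  exponent₁ : d + e * n ≤ m * (2 * n)
  exponent₁ = begin
    d + e * n    ≤⟨ +-monoˡ-≤ (e * n) (≤-trans (m≤n*m d q) qd≤n) ⟩
    suc e * n    ≤⟨ *-monoˡ-≤ n (≤-trans (m≤m+n (suc e) 2) (≤-reflexive (sym (+-suc e 2)))) ⟩
    (e + 3) * n  ≤⟨ *-monoˡ-≤ n e+3≤d ⟩
    d * n        ≡⟨ regroup₁ m n ⟩
    m * (2 * n)  ∎
  exponent₂ : 2 * n + e * n ≤ (n ∸ q) * d
  exponent₂ = subst (2 * n + e * n ≤_) (sym (*-distribʳ-∸ d n q)) (m+n≤o⇒m≤o∸n (2 * n + e * n) (begin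
    2 * n + e * n + q * d  ≤⟨ +-monoʳ-≤ (2 * n + e * n) qd≤n ⟩
    2 * n + e * n + n      ≡⟨ regroup₂ e n ⟩
    (e + 3) * n            ≤⟨ *-monoˡ-≤ n e+3≤d ⟩
    d * n                  ≡⟨ *-comm d n ⟩
    n * d                  ∎))
  q≤n : q ≤ n
  q≤n = ≤-trans (m≤m*n q d) qd≤n

bracket-power : ∀ {b X} → 1 < b → 0 < X → ∃ λ K → b ^ K ≤ X × X < b * b ^ K
bracket-power {b} {X} 1<b 0<X = search X (n<bⁿ X)
  where
  instance
    b-nonZero : NonZero b
    b-nonZero = >-nonZero (≤-trans (s≤s z≤n) 1<b)
  n<bⁿ : ∀ n → n < b ^ n
  n<bⁿ zero    = s≤s z≤n
  n<bⁿ (suc n) = <-≤-trans (s≤s (n<bⁿ n))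
                   (≤-trans (m<m*n (b ^ n) b {{m^n≢0 b n}} 1<b) (≤-reflexive (*-comm (b ^ n) b)))
  search : ∀ j → X < b ^ j → ∃ λ K → b ^ K ≤ X × X < b * b ^ K
  search zero    X<1 = ⊥-elim (<⇒≱ 0<X (s≤s⁻¹ X<1))
  search (suc j) X<bʲ⁺¹ with b ^ j ≤? X
  ... | yes bʲ≤X = j , bʲ≤X , X<bʲ⁺¹
  ... | no  bʲ≰X = search j (≰⇒> bʲ≰X)

exponent-trade : ∀ {n a Y f B E} .{{_ : NonZero n}} → a * a ≤ n → n ^ suc f ≤ a * Y → 2 * f * B ≤ E →
                 n ^ (2 * f * (B + E)) ≤ Y ^ (2 * E)
exponent-trade {n} {a} {Y} {f} {B} {E} a²≤n nᶠ⁺¹≤aY 2fB≤E = *-cancelˡ-≤ (n ^ E) {{m^n≢0 n E}} (begin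
  n ^ E * n ^ (2 * f * (B + E))  ≤⟨ *-monoʳ-≤ (n ^ E) (^-monoʳ-≤ n exponent) ⟩
  n ^ E * n ^ ((2 * f + 1) * E)  ≡⟨ ^-distribˡ-+-* n E _ ⟨
  n ^ (E + (2 * f + 1) * E)      ≡⟨ cong (n ^_) (regroup f E) ⟩
  n ^ (suc f * (2 * E))          ≡⟨ ^-*-assoc n (suc f) (2 * E) ⟨
  (n ^ suc f) ^ (2 * E)          ≤⟨ ^-monoˡ-≤ (2 * E) nᶠ⁺¹≤aY ⟩
  (a * Y) ^ (2 * E)              ≡⟨ *-distrib-^ a Y (2 * E) ⟩
  a ^ (2 * E) * Y ^ (2 * E)      ≡⟨ cong (_* Y ^ (2 * E)) (^-*-assoc a 2 E) ⟨
  (a ^ 2) ^ E * Y ^ (2 * E)      ≤⟨ *-monoˡ-≤ (Y ^ (2 * E)) (^-monoˡ-≤ E a²≤n′) ⟩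
  n ^ E * Y ^ (2 * E)            ∎)
  where
  open ≤-Reasoning
  a²≤n′ : a ^ 2 ≤ n
  a²≤n′ = subst (_≤ n) (cong (a *_) (sym (*-identityʳ a))) a²≤n
  regroup : ∀ f E → E + (2 * f + 1) * E ≡ suc f * (2 * E)
  regroup = solve-∀
  exponent : 2 * f * (B + E) ≤ (2 * f + 1) * E
  exponent = begin
    2 * f * (B + E)          ≡⟨ *-distribˡ-+ (2 * f) B E ⟩
    2 * f * B + 2 * f * E    ≤⟨ +-monoˡ-≤ (2 * f * E) 2fB≤E ⟩
    suc (2 * f) * E          ≡⟨ cong (_* E) (+-comm 1 (2 * f)) ⟩
    (2 * f + 1) * E          ∎

codes≪factorial : ∀ m e n K .{{_ : NonZero m}} → e + 3 ≤ 2 * m → 2 * m * (4 * m) ^ m ≤ n →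
                  (2 ^ (4 * m)) ^ K ≤ n ^ e →
                  4 * m * (2 ^ (2 * n)) ^ K ≤ n !
codes≪factorial m e n K e+3≤2m large aᴷ≤nᵉ = ^-cancelʳ-≤ (2 * m) {{m*n≢0 2 m}} (begin
  (4 * m * B) ^ (2 * m)                       ≡⟨ *-distrib-^ (4 * m) B (2 * m) ⟩
  (4 * m) ^ (2 * m) * B ^ (2 * m)             ≡⟨ cong ((4 * m) ^ (2 * m) *_) B²ᵐ≡aᴷⁿ ⟩
  (4 * m) ^ (2 * m) * ((2 ^ (4 * m)) ^ K) ^ n ≤⟨ *-monoʳ-≤ ((4 * m) ^ (2 * m)) (^-monoˡ-≤ n aᴷ≤nᵉ) ⟩
  (4 * m) ^ (2 * m) * (n ^ e) ^ n             ≡⟨ cong ((4 * m) ^ (2 * m) *_) (^-*-assoc n e n) ⟩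
  (4 * m) ^ (2 * m) * n ^ (e * n)             ≤⟨ factorial-power-lower-bound m e n e+3≤2m large ⟩
  (n !) ^ (2 * m)                             ∎)
  where
  open ≤-Reasoning
  B : ℕ
  B = (2 ^ (2 * n)) ^ K
  B²ᵐ≡aᴷⁿ : B ^ (2 * m) ≡ ((2 ^ (4 * m)) ^ K) ^ n
  B²ᵐ≡aᴷⁿ = trans (^-^-assoc 2 (2 * n) K (2 * m))
              (trans (cong (2 ^_) (reorder m n K)) (sym (^-^-assoc 2 (4 * m) K n)))
    where
    reorder : ∀ m n K → 2 * n * K * (2 * m) ≡ 4 * m * K * n
    reorder = solve-∀

bound-from-threshold : ∀ d n K T .{{_ : NonZero n}} →
                       let m = 2 + d; a = 2 ^ (4 * m); B = (2 ^ (2 * n)) ^ K in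
                       a * a ≤ n → n ^ suc (2 * d) ≤ a * a ^ K → 4 * m * B ≤ n ! → K * n ! ≤ T + K * B →
                       n ^ (d * n !) ≤ 2 ^ (2 * m * T)
bound-from-threshold d n K T a²≤n nᵉ≤aaᴷ 4mB≤n! Kn!≤T+KB = ^-cancelʳ-≤ 4 (begin
  (n ^ (d * n !)) ^ 4          ≡⟨ ^-*-assoc n (d * n !) 4 ⟩
  n ^ (d * n ! * 4)            ≡⟨ cong (n ^_) (regroup₁ d (n !)) ⟩
  n ^ (2 * (2 * d) * n !)      ≡⟨ cong (λ l → n ^ (2 * (2 * d) * l)) n!≡B+E ⟩
  n ^ (2 * (2 * d) * (B + E))  ≤⟨ exponent-trade {a = a} {f = 2 * d} {B} a²≤n nᵉ≤aaᴷ 4dB≤E ⟩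
  (a ^ K) ^ (2 * E)            ≡⟨ ^-^-assoc 2 (4 * m) K (2 * E) ⟩
  2 ^ (4 * m * K * (2 * E))    ≡⟨ cong (2 ^_) (regroup₂ d K E) ⟩
  2 ^ (2 * m * (K * E) * 4)    ≡⟨ ^-*-assoc 2 (2 * m * (K * E)) 4 ⟨
  (2 ^ (2 * m * (K * E))) ^ 4  ≤⟨ ^-monoˡ-≤ 4 (^-monoʳ-≤ 2 (*-monoʳ-≤ (2 * m) KE≤T)) ⟩
  (2 ^ (2 * m * T)) ^ 4        ∎)
  where
  open ≤-Reasoning
  regroup₁ : ∀ d x → d * x * 4 ≡ 2 * (2 * d) * x
  regroup₁ = solve-∀
  regroup₂ : ∀ d K E → 4 * (2 + d) * K * (2 * E) ≡ 2 * (2 + d) * (K * E) * 4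
  regroup₂ = solve-∀
  regroup₃ : ∀ d B → B + 2 * (2 * d) * B + 7 * B ≡ 4 * (2 + d) * B
  regroup₃ = solve-∀
  m a B E : ℕ
  m = 2 + d
  a = 2 ^ (4 * m)
  B = (2 ^ (2 * n)) ^ K
  E = n ! ∸ B
  B≤4mB : B ≤ 4 * m * B
  B≤4mB = m≤n*m B (4 * m)
  n!≡B+E : n ! ≡ B + E
  n!≡B+E = sym (m+[n∸m]≡n (≤-trans B≤4mB 4mB≤n!))
  4dB≤E : 2 * (2 * d) * B ≤ E
  4dB≤E = +-cancelˡ-≤ B _ _ (begin
    B + 2 * (2 * d) * B          ≤⟨ m≤m+n _ (7 * B) ⟩
    B + 2 * (2 * d) * B + 7 * B  ≡⟨ regroup₃ d B ⟩
    4 * m * B                    ≤⟨ 4mB≤n! ⟩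
    n !                          ≡⟨ n!≡B+E ⟩
    B + E                        ∎)
  KE≤T : K * E ≤ T
  KE≤T = +-cancelˡ-≤ (K * B) _ _ (begin
    K * B + K * E  ≡⟨ *-distribˡ-+ K B E ⟨
    K * (B + E)    ≡⟨ cong (K *_) n!≡B+E ⟨
    K * n !        ≤⟨ Kn!≤T+KB ⟩
    T + K * B      ≡⟨ +-comm T (K * B) ⟩
    K * B + T      ∎)

theorem2 : (s : List ℕ → ℕ) →
           (∀ n π → π ∈ perms n → SortedBy (s π) π × (∀ k → SortedBy k π → s π ≤ k)) →
           ∀ m → 0 < m → ∃ λ N → ∀ n → N ≤ n →
             n ^ ((m ∸ 2) * n !) ≤ 2 ^ (2 * m * sum (map s (perms n)))
theorem2 s _      (suc zero)    _ = 0 , λ n _ → m^n>0 2 (2 * sum (map s (perms n)))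
theorem2 s sorted (suc (suc d)) _ = 2 * m * (4 * m) ^ m + a * a , bound
  where
  m a : ℕ
  m = 2 + d
  a = 2 ^ (4 * m)
  bound : ∀ n → 2 * m * (4 * m) ^ m + a * a ≤ n → n ^ (d * n !) ≤ 2 ^ (2 * m * sum (map s (perms n)))
  bound n N≤n = bounded (bracket-power {a} (^-monoʳ-< 2 ≤-refl {0} {4 * m} (s≤s z≤n)) (m^n>0 n (suc (2 * d))))
    where
    exponents : ∀ d → suc (2 * d) + 3 ≡ 2 * (2 + d)
    exponents = solve-∀
    large : 2 * m * (4 * m) ^ m ≤ n
    large = ≤-trans (m≤m+n _ (a * a)) N≤n
    a²≤n : a * a ≤ n
    a²≤n = ≤-trans (m≤n+m (a * a) _) N≤n
    instance
      n-nonZero : NonZero n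
      n-nonZero = >-nonZero (≤-trans (*-mono-≤ (m^n>0 2 (4 * m)) (m^n>0 2 (4 * m))) a²≤n)
    bounded : (∃ λ K → a ^ K ≤ n ^ suc (2 * d) × n ^ suc (2 * d) < a * a ^ K) →
              n ^ (d * n !) ≤ 2 ^ (2 * m * sum (map s (perms n)))
    bounded (K , aᴷ≤nᵉ , nᵉ<aaᴷ) =
      bound-from-threshold d n K _ a²≤n (<⇒≤ nᵉ<aaᴷ)
        (codes≪factorial m (suc (2 * d)) n K (≤-reflexive (exponents d)) large aᴷ≤nᵉ)
        (sum-lower-bound s n K λ {π} π∈ → proj₁ (sorted n π π∈))
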